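{- The property "acyclic oriented graphs" is strongly $1/2$-extendible in the class of oriented graphs.
   Context: An oriented graph is a finite directed graph without loops in which between any two vertices there is at most one arc; its underlying simple graph forgets orientations, and blocks, connectivity etc. refer to it. For $0<\lambda<1$, a property $\Pi$ of oriented graphs is strongly $\lambda$-extendible if: every oriented graph whose underlying simple graph is $K_1$ or $K_2$ is in $\Pi$; an oriented graph is in $\Pi$ iff each of its blocks (maximal connected subgraphs without a cut vertex, with inherited orientations) is in $\Pi$; and for every oriented graph $G$, $S\subseteq V(G)$ with $G[S]\in\Pi$ and $G\setminus S=G[V(G)\setminus S]\in\Pi$, and every weight function $c:E(G)\to\mathbb{R}^+$, there is $F\subseteq\delta(S)$ (arcs with exactly one endpoint in $S$) with $c(F)\ge\lambda c(\delta(S))$ such that deleting the arcs $\delta(S)\setminus F$ from $G$ yields a graph in $\Pi$.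
   Formalization: The weight functions c in the definition of strong extendibility take positive rational values instead of positive real ones. -}

module Defs where

open import Data.Nat using (ℕ; zero; suc)
open import Data.Fin using (Fin)
import Data.Fin as Fin
open import Data.Bool using (Bool; true; false; _∧_; _∨_; not; _xor_; if_then_else_)
open import Data.Bool.Properties using (∧-zeroʳ)
open import Data.Product using (Σ; _×_; _,_; ∃; proj₁; proj₂)
open import Data.Sum using (_⊎_)
open import Data.Empty using (⊥)
open import Relation.Nullary using (¬_)
open import Relation.Binary.PropositionalEquality using (_≡_; _≢_; refl; cong)
open import Data.Rational using (ℚ; 0ℚ; _+_; _*_; _≤_; _<_)
open import Function.Bundles using (_⇔_)

record OGraph (V : Set) : Set where
  field
    arc    : V → V → Bool
    irrefl : ∀ v → arc v v ≡ false
    asym   : ∀ u v → arc u v ≡ true → arc v u ≡ false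
open OGraph public

Property : Set₁
Property = {V : Set} → OGraph V → Set

VSet : ℕ → Set
VSet n = Fin n → Bool

_⊆_ : ∀ {n} → VSet n → VSet n → Set
A ⊆ B = ∀ v → A v ≡ true → B v ≡ true

induced : ∀ {n} → OGraph (Fin n) → (S : VSet n) → OGraph (Σ (Fin n) λ v → S v ≡ true)
induced G S = record
  { arc    = λ u v → arc G (proj₁ u) (proj₁ v)
  ; irrefl = λ v → irrefl G (proj₁ v)
  ; asym   = λ u v → asym G (proj₁ u) (proj₁ v) }

Adj : ∀ {V} → OGraph V → V → V → Set
Adj G u v = (arc G u v ≡ true) ⊎ (arc G v u ≡ true)

data Reach {n} (G : OGraph (Fin n)) (S : VSet n) : Fin n → Fin n → Set where
  here  : ∀ {u} → Reach G S u u
  there : ∀ {u w v} → Adj G u w → S w ≡ true → Reach G S w v → Reach G S u v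

-- G[S] is connected (the empty graph counts as connected here)
Connected : ∀ {n} → OGraph (Fin n) → VSet n → Set
Connected G S = ∀ u v → S u ≡ true → S v ≡ true → Reach G S u v

remove : ∀ {n} → VSet n → Fin n → VSet n
remove S v w with v Fin.≟ w
... | Relation.Nullary.yes _ = false
... | Relation.Nullary.no _  = S w

Nonseparable : ∀ {n} → OGraph (Fin n) → VSet n → Set
Nonseparable G B =
  (∃ λ v → B v ≡ true) × Connected G B × (∀ v → B v ≡ true → Connected G (remove B v))

-- B is (the vertex set of) a block: a maximal nonseparable subgraph.
-- (Blocks are induced subgraphs.)
IsBlock : ∀ {n} → OGraph (Fin n) → VSet n → Set
IsBlock G B = Nonseparable G B × (∀ B' → B ⊆ B' → Nonseparable G B' → B' ⊆ B)

sumFin : ∀ n → (Fin n → ℚ) → ℚ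
sumFin zero    f = 0ℚ
sumFin (suc n) f = f Fin.zero + sumFin n (λ i → f (Fin.suc i))

weight : ∀ {n} → OGraph (Fin n) → (Fin n → Fin n → ℚ) → (Fin n → Fin n → Bool) → ℚ
weight {n} G c P = sumFin n λ u → sumFin n λ v → if arc G u v ∧ P u v then c u v else 0ℚ

cut : ∀ {n} → VSet n → Fin n → Fin n → Bool
cut S u v = S u xor S v

restrictArcs : ∀ {V} → OGraph V → (V → V → Bool) → OGraph V
restrictArcs G K = record
  { arc    = λ u v → arc G u v ∧ K u v
  ; irrefl = λ v → irr v
  ; asym   = λ u v p → as u v p }
  where
  irr : ∀ v → arc G v v ∧ K v v ≡ false
  irr v rewrite irrefl G v = refl
  as : ∀ u v → arc G u v ∧ K u v ≡ true → arc G v u ∧ K v u ≡ false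
  as u v p with arc G u v in e
  as u v p | true rewrite asym G u v e = refl

deleteCutExcept : ∀ {n} → OGraph (Fin n) → VSet n → (Fin n → Fin n → Bool) → OGraph (Fin n)
deleteCutExcept G S F = restrictArcs G (λ u v → not (cut S u v) ∨ F u v)

StronglyExtendible : ℚ → Property → Set
StronglyExtendible λ' Π =
    (∀ (G : OGraph (Fin 1)) → Π G)
  × (∀ (G : OGraph (Fin 2)) → Adj G Fin.zero (Fin.suc Fin.zero) → Π G)
  × (∀ n (G : OGraph (Fin n)) → Π G ⇔ (∀ B → IsBlock G B → Π (induced G B)))
  × (∀ n (G : OGraph (Fin n)) (S : VSet n) →
       Π (induced G S) → Π (induced G (λ v → not (S v))) →
       (c : Fin n → Fin n → ℚ) → (∀ u v → arc G u v ≡ true → 0ℚ < c u v) →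
       ∃ λ (F : Fin n → Fin n → Bool) →
           (∀ u v → F u v ≡ true → arc G u v ≡ true × cut S u v ≡ true)
         × (λ' * weight G c (cut S) ≤ weight G c F)
         × Π (deleteCutExcept G S F))

data DPath {V} (G : OGraph V) : V → V → Set where
  step : ∀ {u v} → arc G u v ≡ true → DPath G u v
  cons : ∀ {u w v} → arc G u w ≡ true → DPath G w v → DPath G u v

Acyclic : Property
Acyclic G = ∀ u → ¬ DPath G u u

-- A directed cycle of minimum length has a nonseparable vertex set (rotating it to start at any
-- vertex x, the rest of the cycle is a walk through all other vertices that avoids x), and a
-- nonseparable set lies in a block; so a graph whose blocks are acyclic is acyclic. For the
-- extension property, split δ(S) into the arcs leaving S and the arcs entering S and keep the
-- heavier of the two: afterwards no path can leave a side and come back, so every directed cycle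
-- lies in G[S] or in G[V ∖ S]. Graphs on one or two vertices are ranked by a topological order.

{-# OPTIONS --safe #-}
module Submission where

open import Defs
open import Data.Rational using (½)

open import Data.Nat as ℕ using (ℕ; z<s)
import Data.Nat.Properties as ℕ
open import Data.Nat.Induction using (<-wellFounded)
open import Data.Fin as Fin using (Fin; toℕ)
open import Data.Fin.Patterns using (0F; 1F)
open import Data.Bool using (Bool; true; false; _∧_; _∨_; not; _xor_; if_then_else_)
open import Data.Bool.Properties using (∧-conicalˡ; not-involutive; not-distribˡ-xor; not-distribʳ-xor)
open import Data.Product using (Σ; ∃; _×_; _,_; proj₁; proj₂; uncurry)
open import Data.Sum using (inj₁; [_,_]′; swap)
open import Data.Empty using (⊥; ⊥-elim)
open import Function.Base using (_∘_; id)
open import Function.Bundles using (mk⇔)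
open import Relation.Nullary using (¬_; yes; no; does)
open import Relation.Nullary.Negation using (¬¬-map; contradiction)
open import Relation.Nullary.Decidable using (¬¬-excluded-middle; dec-true)
open import Relation.Unary using (Pred)
open import Relation.Binary.Core using (Rel)
open import Relation.Binary.PropositionalEquality
open import Data.Rational using (ℚ; 0ℚ; _+_; _*_; _≤_)
import Data.Rational.Properties as ℚ
import Relation.Binary.Construct.On as On
open import Induction.WellFounded using (WellFounded; Acc; acc)
open import Data.List using (List; []; _∷_; _++_; length)
open import Data.List.Properties using (length-++)
open import Data.List.Membership.Propositional using (_∈_)
open import Data.List.Relation.Unary.Any using (here; there)
open import Data.List.Relation.Unary.All as All using (All; _∷_)
open import Data.List.Relation.Binary.Permutation.Propositional using (_↭_; ↭-sym; module PermutationReasoning)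
open import Data.List.Relation.Binary.Permutation.Propositional.Properties using (++-comm; ∈-resp-↭; ↭-length)
open import Relation.Binary.Construct.Closure.ReflexiveTransitive using (Star; ε; _◅_; _◅◅_)
open import Data.Vec using (tabulate)
open import Data.Vec.Properties using (lookup∘tabulate; []=⇒lookup; lookup⇒[]=)
import Data.Fin.Subset as Subset
open import Data.Fin.Subset.Induction using (⊃-wellFounded)
open import Algebra.Properties.CommutativeMonoid.Sum ℚ.+-0-commutativeMonoid
  using (sum; sum-cong-≗; ∑-distrib-+)

¬¬-minimal : ∀ {a r p} {A : Set a} {_<_ : Rel A r} → WellFounded _<_ →
             (P : Pred A p) → ∀ {x} → P x →
             ¬ ¬ ∃ λ m → P m × (∀ {y} → P y → ¬ y < m)
¬¬-minimal {A = A} {_<_} wf P {x} px = descend x (wf x) px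
  where
  descend : ∀ x → Acc _<_ x → P x → ¬ ¬ ∃ λ m → P m × (∀ {y} → P y → ¬ y < m)
  descend x (acc smaller) px noMinimum =
    ¬¬-excluded-middle {A = ∃ λ y → P y × y < x} λ where
    (yes (y , py , y<x)) → descend y (smaller y<x) py noMinimum
    (no none)            → noMinimum (x , px , λ py y<x → none (_ , py , y<x))

module _ {V : Set} (G : OGraph V) where

  no-loop : ∀ {v} → arc G v v ≡ true → ⊥
  no-loop {v} a with () ← trans (sym a) (irrefl G v)

  no-2-cycle : ∀ {u v} → arc G u v ≡ true → arc G v u ≡ true → ⊥
  no-2-cycle {u} {v} a b with () ← trans (sym b) (asym G u v a)

  ranked⇒acyclic : (rank : V → ℕ) → (∀ u v → arc G u v ≡ true → rank u ℕ.< rank v) → Acyclic G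
  ranked⇒acyclic rank ascending u cycle = ℕ.<-irrefl refl (rank-increases cycle)
    where
    rank-increases : ∀ {u v} → DPath G u v → rank u ℕ.< rank v
    rank-increases (step a)   = ascending _ _ a
    rank-increases (cons a p) = ℕ.<-trans (ascending _ _ a) (rank-increases p)

IsHomomorphism : ∀ {V W} → OGraph V → OGraph W → (V → W) → Set
IsHomomorphism H G f = ∀ u v → arc H u v ≡ true → arc G (f u) (f v) ≡ true

module _ {V W : Set} {H : OGraph V} {G : OGraph W} {f : V → W} (hom : IsHomomorphism H G f) where

  map-path : ∀ {u v} → DPath H u v → DPath G (f u) (f v)
  map-path (step a)   = step (hom _ _ a)
  map-path (cons a p) = cons (hom _ _ a) (map-path p)

  acyclic-reflected : Acyclic G → Acyclic H
  acyclic-reflected acyclic u cycle = acyclic (f u) (map-path cycle)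

module _ {n} (G : OGraph (Fin n)) where

  induced-acyclic : Acyclic G → (B : VSet n) → Acyclic (induced G B)
  induced-acyclic acyclic B = acyclic-reflected {f = proj₁} (λ _ _ a → a) acyclic

  induced-antitone : ∀ {R R′} → R ⊆ R′ → Acyclic (induced G R′) → Acyclic (induced G R)
  induced-antitone R⊆R′ = acyclic-reflected {f = λ (v , p) → v , R⊆R′ v p} (λ _ _ a → a)

  restrict-acyclic : ∀ K (R : VSet n) → Acyclic (induced G R) → Acyclic (induced (restrictArcs G K) R)
  restrict-acyclic K R = acyclic-reflected {f = id} (λ u v → ∧-conicalˡ _ _)

acyclic-Fin1 : (G : OGraph (Fin 1)) → Acyclic G
acyclic-Fin1 G = ranked⇒acyclic G (λ _ → 0) λ { 0F 0F a → ⊥-elim (no-loop G a) }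

acyclic-Fin2 : (G : OGraph (Fin 2)) → Acyclic G
acyclic-Fin2 G with arc G 0F 1F in forward
... | true  = ranked⇒acyclic G toℕ ascending
  where
  ascending : ∀ u v → arc G u v ≡ true → toℕ u ℕ.< toℕ v
  ascending 0F 0F a = ⊥-elim (no-loop G a)
  ascending 0F 1F a = z<s
  ascending 1F 0F a = ⊥-elim (no-2-cycle G forward a)
  ascending 1F 1F a = ⊥-elim (no-loop G a)
... | false = ranked⇒acyclic G (toℕ ∘ Fin.opposite) descending
  where
  descending : ∀ u v → arc G u v ≡ true → toℕ (Fin.opposite u) ℕ.< toℕ (Fin.opposite v)
  descending 0F 0F a = ⊥-elim (no-loop G a)
  descending 0F 1F a with () ← trans (sym forward) a
  descending 1F 0F a = z<s
  descending 1F 1F a = ⊥-elim (no-loop G a)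

module _ {n} (G : OGraph (Fin n)) where

  lift-path : ∀ (R : VSet n) →
              (∀ {x w v} → R x ≡ true → arc G x w ≡ true → DPath G w v → R v ≡ true → R w ≡ true) →
              ∀ {u v} (pu : R u ≡ true) (pv : R v ≡ true) →
              DPath G u v → DPath (induced G R) (u , pu) (v , pv)
  lift-path R convex pu pv (step a)   = step a
  lift-path R convex pu pv (cons a p) = cons a (lift-path R convex (convex pu a p pv) pv p)

  acyclic-if-no-arc-enters : (σ : VSet n) → (∀ u v → arc G u v ≡ true → σ v ≡ true → σ u ≡ true) →
                             Acyclic (induced G σ) → Acyclic (induced G (not ∘ σ)) → Acyclic G
  acyclic-if-no-arc-enters σ no-entry acyclic-in acyclic-out u cycle with σ u in side
  ... | true  = acyclic-in  _ (lift-path σ (λ _ _ p → backward p) side side cycle)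
    where
    backward : ∀ {w v} → DPath G w v → σ v ≡ true → σ w ≡ true
    backward (step a)   = no-entry _ _ a
    backward (cons a p) = no-entry _ _ a ∘ backward p
  ... | false = acyclic-out _
                  (lift-path (not ∘ σ) (λ out a _ _ → forward out a) (cong not side) (cong not side) cycle)
    where
    forward : ∀ {x w} → not (σ x) ≡ true → arc G x w ≡ true → not (σ w) ≡ true
    forward {w = w} out a with σ w in inside
    ... | false = refl
    ... | true with () ← trans (sym out) (cong not (no-entry _ _ a inside))

outArcs : ∀ {n} → OGraph (Fin n) → VSet n → Fin n → Fin n → Bool
outArcs G σ u v = arc G u v ∧ (σ u ∧ not (σ v))

out-arc⇒cut-arc : ∀ a x y → a ∧ (x ∧ not y) ≡ true → a ≡ true × x xor y ≡ true
out-arc⇒cut-arc true true false _ = refl , refl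

kept-arc-does-not-enter : ∀ a x y → a ∧ (not (x xor y) ∨ a ∧ (x ∧ not y)) ≡ true →
                          y ≡ true → x ≡ true
kept-arc-does-not-enter true true  _    _ _ = refl
kept-arc-does-not-enter true false true () _

cut-complement : ∀ {n} (S : VSet n) u v → cut (not ∘ S) u v ≡ cut S u v
cut-complement S u v = begin
  not (S u) xor not (S v)   ≡⟨ not-distribˡ-xor (S u) (not (S v)) ⟨
  not (S u xor not (S v))   ≡⟨ cong not (not-distribʳ-xor (S u) (S v)) ⟨
  not (not (S u xor S v))   ≡⟨ not-involutive _ ⟩
  S u xor S v               ∎
  where open ≡-Reasoning

keep-out-arcs-acyclic : ∀ {n} (G : OGraph (Fin n)) (S σ : VSet n) → (∀ u v → cut σ u v ≡ cut S u v) →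
                        Acyclic (induced G σ) → Acyclic (induced G (not ∘ σ)) →
                        Acyclic (deleteCutExcept G S (outArcs G σ))
keep-out-arcs-acyclic {n} G S σ same-cut acyclic-in acyclic-out =
  acyclic-if-no-arc-enters H σ no-entry
    (restrict-acyclic G _ σ acyclic-in) (restrict-acyclic G _ (not ∘ σ) acyclic-out)
  where
  H : OGraph (Fin n)
  H = deleteCutExcept G S (outArcs G σ)
  no-entry : ∀ u v → arc H u v ≡ true → σ v ≡ true → σ u ≡ true
  no-entry u v a = kept-arc-does-not-enter (arc G u v) (σ u) (σ v)
    (subst (λ b → arc G u v ∧ (not b ∨ outArcs G σ u v) ≡ true) (sym (same-cut u v)) a)

sumFin≡sum : ∀ n (f : Fin n → ℚ) → sumFin n f ≡ sum f
sumFin≡sum ℕ.zero    f = refl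
sumFin≡sum (ℕ.suc n) f = cong (f 0F +_) (sumFin≡sum n (f ∘ Fin.suc))

sumFin-split : ∀ {n} {h f g : Fin n → ℚ} → (∀ i → h i ≡ f i + g i) →
               sumFin n h ≡ sumFin n f + sumFin n g
sumFin-split {n} {h} {f} {g} h≗f+g = begin
  sumFin n h                ≡⟨ sumFin≡sum n h ⟩
  sum h                     ≡⟨ sum-cong-≗ h≗f+g ⟩
  sum (λ i → f i + g i)     ≡⟨ ∑-distrib-+ f g ⟩
  sum f + sum g             ≡⟨ cong₂ _+_ (sumFin≡sum n f) (sumFin≡sum n g) ⟨
  sumFin n f + sumFin n g   ∎
  where open ≡-Reasoning

cut-summand-split : ∀ a x y (q : ℚ) →
  (if a ∧ (x xor y) then q else 0ℚ) ≡
  (if a ∧ (a ∧ (x ∧ not y)) then q else 0ℚ) + (if a ∧ (a ∧ (not x ∧ not (not y))) then q else 0ℚ)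
cut-summand-split false _     _     q = sym (ℚ.+-identityʳ 0ℚ)
cut-summand-split true  true  true  q = sym (ℚ.+-identityʳ 0ℚ)
cut-summand-split true  true  false q = sym (ℚ.+-identityʳ q)
cut-summand-split true  false true  q = sym (ℚ.+-identityˡ q)
cut-summand-split true  false false q = sym (ℚ.+-identityʳ 0ℚ)

weight-cut-split : ∀ {n} (G : OGraph (Fin n)) c (S : VSet n) →
                   weight G c (cut S) ≡ weight G c (outArcs G S) + weight G c (outArcs G (not ∘ S))
weight-cut-split G c S =
  sumFin-split λ u → sumFin-split λ v → cut-summand-split (arc G u v) (S u) (S v) (c u v)

half-sum≤ : ∀ {a b} → b ≤ a → ½ * (a + b) ≤ a
half-sum≤ {a} {b} b≤a = begin
  ½ * (a + b)      ≤⟨ ℚ.*-monoˡ-≤-nonNeg ½ (ℚ.+-monoʳ-≤ a b≤a) ⟩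
  ½ * (a + a)      ≡⟨ ℚ.*-distribˡ-+ ½ a a ⟩
  ½ * a + ½ * a    ≡⟨ ℚ.*-distribʳ-+ a ½ ½ ⟨
  (½ + ½) * a      ≡⟨ ℚ.*-identityˡ a ⟩
  a                ∎
  where open ℚ.≤-Reasoning

ExtendingSubcut : ℚ → Property → ∀ {n} → OGraph (Fin n) → VSet n → (Fin n → Fin n → ℚ) → Set
ExtendingSubcut λ′ Π {n} G S c =
  ∃ λ (F : Fin n → Fin n → Bool) →
      (∀ u v → F u v ≡ true → arc G u v ≡ true × cut S u v ≡ true)
    × (λ′ * weight G c (cut S) ≤ weight G c F)
    × Π (deleteCutExcept G S F)

keep-heavier-direction : ∀ {n} (G : OGraph (Fin n)) (S : VSet n) →
                         Acyclic (induced G S) → Acyclic (induced G (not ∘ S)) →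
                         (c : Fin n → Fin n → ℚ) → ExtendingSubcut ½ Acyclic G S c
keep-heavier-direction G S acyclic-in acyclic-out c = [ keep-out , keep-in ]′ (ℚ.≤-total w-in w-out)
  where
  w-out w-in : ℚ
  w-out = weight G c (outArcs G S)
  w-in  = weight G c (outArcs G (not ∘ S))
  keep-out : w-in ≤ w-out → ExtendingSubcut ½ Acyclic G S c
  keep-out w-in≤w-out =
    outArcs G S ,
    (λ u v → out-arc⇒cut-arc (arc G u v) (S u) (S v)) ,
    subst (λ w → ½ * w ≤ w-out) (sym (weight-cut-split G c S)) (half-sum≤ w-in≤w-out) ,
    keep-out-arcs-acyclic G S S (λ _ _ → refl) acyclic-in acyclic-out
  keep-in : w-out ≤ w-in → ExtendingSubcut ½ Acyclic G S c
  keep-in w-out≤w-in =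
    outArcs G (not ∘ S) ,
    (λ u v a → subst (λ b → arc G u v ≡ true × b ≡ true) (cut-complement S u v)
                 (out-arc⇒cut-arc (arc G u v) (not (S u)) (not (S v)) a)) ,
    subst (λ w → ½ * w ≤ w-in) (sym (trans (weight-cut-split G c S) (ℚ.+-comm w-out w-in)))
      (half-sum≤ w-out≤w-in) ,
    keep-out-arcs-acyclic G S (not ∘ S) (cut-complement S) acyclic-out
      (induced-antitone G (λ v → subst (_≡ true) (not-involutive (S v))) acyclic-in)

module _ {n} {G : OGraph (Fin n)} {S : VSet n} where

  reach-trans : ∀ {u w v} → Reach G S u w → Reach G S w v → Reach G S u v
  reach-trans here              q = q
  reach-trans (there adj sw p) q = there adj sw (reach-trans p q)

  reach-sym : ∀ {u v} → S u ≡ true → Reach G S u v → Reach G S v u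
  reach-sym su here              = here
  reach-sym su (there adj sw p) = reach-trans (reach-sym sw p) (there (swap adj) su here)

module _ {n} {S : VSet n} {x w : Fin n} where

  remove-keeps : x ≢ w → S w ≡ true → remove S x w ≡ true
  remove-keeps x≢w sw with x Fin.≟ w
  ... | yes x≡w = ⊥-elim (x≢w x≡w)
  ... | no _    = sw

  remove-⊆ : remove S x w ≡ true → S w ≡ true × x ≢ w
  remove-⊆ kept with x Fin.≟ w
  ... | no x≢w = kept , x≢w

module _ {n : ℕ} where
  open import Data.List.Membership.DecPropositional (Fin._≟_ {n}) public using (_∈?_)

  listSet : List (Fin n) → VSet n
  listSet xs y = does (y ∈? xs)

  listSet⁺ : ∀ {xs y} → y ∈ xs → listSet xs y ≡ true
  listSet⁺ {xs} {y} = dec-true (y ∈? xs)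

  listSet⁻ : ∀ {xs y} → listSet xs y ≡ true → y ∈ xs
  listSet⁻ {xs} {y} member with y ∈? xs
  ... | yes y∈xs = y∈xs

module _ {n} (G : OGraph (Fin n)) where

  Walk : Fin n → Fin n → Set
  Walk = Star (λ u v → arc G u v ≡ true)

  -- The final vertex is omitted, which makes vertices additive under ◅◅ and invariant (up to
  -- permutation) under rotation of closed walks.
  vertices : ∀ {u v} → Walk u v → List (Fin n)
  vertices ε              = []
  vertices (_◅_ {u} _ p) = u ∷ vertices p

  len : ∀ {u v} → Walk u v → ℕ
  len = length ∘ vertices

  vertices-◅◅ : ∀ {u w v} (p : Walk u w) (q : Walk w v) →
                vertices (p ◅◅ q) ≡ vertices p ++ vertices q
  vertices-◅◅ ε       q = refl
  vertices-◅◅ (a ◅ p) q = cong (_ ∷_) (vertices-◅◅ p q)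

  record SplitAt {u v} (p : Walk u v) (x : Fin n) : Set where
    field
      next   : Fin n
      before : Walk u x
      leave  : arc G x next ≡ true
      after  : Walk next v
      splits : vertices p ≡ vertices before ++ x ∷ vertices after

  split-at : ∀ {u v x} (p : Walk u v) → x ∈ vertices p → SplitAt p x
  split-at (a ◅ p) (here refl) = record { before = ε ; leave = a ; after = p ; splits = refl }
  split-at (a ◅ p) (there x∈p) =
    let s = split-at p x∈p in
    record { SplitAt s ; before = a ◅ SplitAt.before s ; splits = cong (_ ∷_) (SplitAt.splits s) }

  before-shorter : ∀ {u v x} {p : Walk u v} (s : SplitAt p x) → len (SplitAt.before s) ℕ.< len p
  before-shorter {x = x} {p} s = begin-strict
    len before                                       <⟨ ℕ.m<m+n (len before) z<s ⟩
    len before ℕ.+ length (x ∷ vertices after)       ≡⟨ length-++ (vertices before) ⟨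
    length (vertices before ++ x ∷ vertices after)   ≡⟨ cong length splits ⟨
    len p                                            ∎
    where
    open SplitAt s
    open ℕ.≤-Reasoning

  rotation-↭ : ∀ {u x} {p : Walk u u} (s : SplitAt p x) →
               x ∷ vertices (SplitAt.after s ◅◅ SplitAt.before s) ↭ vertices p
  rotation-↭ {x = x} {p} s = begin
    x ∷ vertices (after ◅◅ before)            ≡⟨ cong (x ∷_) (vertices-◅◅ after before) ⟩
    (x ∷ vertices after) ++ vertices before   ↭⟨ ++-comm (x ∷ vertices after) (vertices before) ⟩
    vertices before ++ x ∷ vertices after     ≡⟨ SplitAt.splits s ⟨
    vertices p                                ∎
    where
    open SplitAt s
    open PermutationReasoning

  module _ {S : VSet n} where

    reach-along : ∀ {w v z} (r : Walk w v) → All (λ y → S y ≡ true) (vertices r) → z ∈ vertices r →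
                  Reach G S w z
    reach-along (a ◅ r)       _                     (here refl) = here
    reach-along (a ◅ (b ◅ r)) (_ ∷ inside@(sw ∷ _)) (there z∈r) =
      there (inj₁ a) sw (reach-along (b ◅ r) inside z∈r)

    walk-connected : ∀ {w v} (r : Walk w v) → All (λ y → S y ≡ true) (vertices r) →
                     (∀ y → S y ≡ true → y ∈ vertices r) → Connected G S
    walk-connected ε       _                covered y z sy _  with () ← covered y sy
    walk-connected (a ◅ r) inside@(sw ∷ _) covered y z sy sz =
      reach-trans (reach-sym sw (reach-along (a ◅ r) inside (covered y sy)))
                  (reach-along (a ◅ r) inside (covered z sz))

  lift-walk : ∀ (B : VSet n) {u w v} (pu : B u ≡ true) (pv : B v ≡ true) →
              arc G u w ≡ true → (r : Walk w v) → All (λ y → B y ≡ true) (vertices r) →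
              DPath (induced G B) (u , pu) (v , pv)
  lift-walk B pu pv a ε       _           = step a
  lift-walk B pu pv a (b ◅ r) (pw ∷ inside) = cons a (lift-walk B pw pv b r inside)

  lift-cycle : ∀ (B : VSet n) {u w} (a : arc G u w ≡ true) (r : Walk w u) →
               All (λ y → B y ≡ true) (vertices (a ◅ r)) → ∃ λ x → DPath (induced G B) x x
  lift-cycle B a r (pu ∷ inside) = _ , lift-walk B pu pu a r inside

  module _ {u w} (a : arc G u w ≡ true) (r : Walk w u)
           (shortest : ∀ {v} (q : Walk v v) → 0 ℕ.< len q → ¬ len q ℕ.< len (a ◅ r)) where

    private
      cycle : Walk u u
      cycle = a ◅ r

      C : VSet n
      C = listSet (vertices cycle)

    -- If x occurred in t, the part of t up to x would close a cycle through x shorter than a ◅ r.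
    connected-without : ∀ {x y} → arc G x y ≡ true → (t : Walk y x) →
                        x ∷ vertices t ↭ vertices cycle → Connected G (remove C x)
    connected-without {x} b t perm with x ∈? vertices t
    ... | yes x∈t = ⊥-elim (shortest (b ◅ before) z<s shortcut)
      where
      open SplitAt (split-at t x∈t)
      shortcut : ℕ.suc (len before) ℕ.< len cycle
      shortcut = ℕ.<-≤-trans (ℕ.s<s (before-shorter (split-at t x∈t)))
                             (ℕ.≤-reflexive (↭-length perm))
    ... | no x∉t = walk-connected t inside covered
      where
      inside : All (λ y → remove C x y ≡ true) (vertices t)
      inside = All.tabulate λ y∈t →
        remove-keeps {S = C} {x} (λ { refl → x∉t y∈t }) (listSet⁺ (∈-resp-↭ perm (there y∈t)))
      covered : ∀ y → remove C x y ≡ true → y ∈ vertices t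
      covered y kept with remove-⊆ {S = C} {x} kept
      ... | y∈C , x≢y with ∈-resp-↭ (↭-sym perm) (listSet⁻ y∈C)
      ...   | here y≡x  = ⊥-elim (x≢y (sym y≡x))
      ...   | there y∈t = y∈t

    shortest-cycle-nonseparable : Nonseparable G C
    shortest-cycle-nonseparable =
        (u , listSet⁺ {xs = vertices cycle} (here refl))
      , walk-connected cycle (All.tabulate listSet⁺) (λ _ → listSet⁻)
      , removal
      where
      removal : ∀ x → C x ≡ true → Connected G (remove C x)
      removal x x∈C = connected-without leave (after ◅◅ before) (rotation-↭ s)
        where
        s : SplitAt cycle x
        s = split-at cycle (listSet⁻ x∈C)
        open SplitAt s

  dpath⇒walk : ∀ {u v} → DPath G u v → Walk u v
  dpath⇒walk (step a)   = a ◅ ε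
  dpath⇒walk (cons a p) = a ◅ dpath⇒walk p

  dpath⇒walk-nontrivial : ∀ {u v} (p : DPath G u v) → 0 ℕ.< len (dpath⇒walk p)
  dpath⇒walk-nontrivial (step _)   = z<s
  dpath⇒walk-nontrivial (cons _ _) = z<s

module _ {n} {B : VSet n} {v : Fin n} where

  ∈-tabulate⁺ : B v ≡ true → v Subset.∈ tabulate B
  ∈-tabulate⁺ bv = lookup⇒[]= v (tabulate B) (trans (lookup∘tabulate B v) bv)

  ∈-tabulate⁻ : v Subset.∈ tabulate B → B v ≡ true
  ∈-tabulate⁻ v∈B = trans (sym (lookup∘tabulate B v)) ([]=⇒lookup v∈B)

module _ {n} (G : OGraph (Fin n)) where

  extend-to-block : ∀ {B} → Nonseparable G B → ¬ ¬ ∃ λ B* → B ⊆ B* × IsBlock G B*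
  extend-to-block {B} nonsep =
    ¬¬-map maximal⇒block
      (¬¬-minimal (On.wellFounded tabulate ⊃-wellFounded) Superblock ((λ _ bv → bv) , nonsep))
    where
    Superblock : VSet n → Set
    Superblock B′ = B ⊆ B′ × Nonseparable G B′

    maximal⇒block : (∃ λ B* → Superblock B* ×
                              (∀ {B′} → Superblock B′ → ¬ tabulate B* Subset.⊂ tabulate B′)) →
                    ∃ λ B* → B ⊆ B* × IsBlock G B*
    maximal⇒block (B* , (B⊆B* , nonsep*) , maximal) = B* , B⊆B* , nonsep* , contained
      where
      contained : ∀ B′ → B* ⊆ B′ → Nonseparable G B′ → B′ ⊆ B*
      contained B′ B*⊆B′ nonsep′ v v∈B′ with B* v in v∈?B*
      ... | true  = refl
      ... | false = ⊥-elim (maximal ((λ w → B*⊆B′ w ∘ B⊆B* w) , nonsep′) strictly-larger)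
        where
        strictly-larger : tabulate B* Subset.⊂ tabulate B′
        strictly-larger =
            ∈-tabulate⁺ ∘ B*⊆B′ _ ∘ ∈-tabulate⁻
          , v , ∈-tabulate⁺ v∈B′ , λ v∈B* → contradiction (trans (sym (∈-tabulate⁻ v∈B*)) v∈?B*) λ ()

  blocks-acyclic⇒acyclic : (∀ B → IsBlock G B → Acyclic (induced G B)) → Acyclic G
  blocks-acyclic⇒acyclic acyclic-blocks u path =
    ¬¬-minimal (On.wellFounded size <-wellFounded) Nontrivial
      {x = u , dpath⇒walk G path} (dpath⇒walk-nontrivial G path) λ where
      ((_ , ε) , () , _)
      ((_ , a ◅ r) , _ , shortest) →
        extend-to-block (shortest-cycle-nonseparable G a r (λ q → shortest {_ , q})) λ (B , C⊆B , block) →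
          uncurry (acyclic-blocks B block) (lift-cycle G B a r (All.tabulate (C⊆B _ ∘ listSet⁺)))
    where
    size : (Σ (Fin n) λ v → Walk G v v) → ℕ
    size (_ , q) = len G q
    Nontrivial : (Σ (Fin n) λ v → Walk G v v) → Set
    Nontrivial q = 0 ℕ.< size q

mainTheorem14 : StronglyExtendible ½ Acyclic
mainTheorem14 =
    acyclic-Fin1
  , (λ G _ → acyclic-Fin2 G)
  , (λ n G → mk⇔ (λ acyclic B _ → induced-acyclic G acyclic B) (blocks-acyclic⇒acyclic G))
  , (λ n G S acyclic-in acyclic-out c _ → keep-heavier-direction G S acyclic-in acyclic-out c)
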